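{- For every closed formula $A$: $\mathsf{IKt}2 \vdash A$ if and only if $\mathfrak{B} \models A$ (i.e. $w \models_{\mathfrak{B}} A$ for every world $w$) for every birelational model $\mathfrak{B}$.
   Context: Formulas: $A ::= P \mid X \mid A\to B \mid \Box A \mid \blacksquare A \mid \forall X A$, with $P$ ranging over propositional symbols and $X$ over second-order variables. Abbreviations: $\bot := \forall X X$, $\neg A := A\to\bot$, $A\land B := \forall X((A\to B\to X)\to X)$, $A\lor B := \forall X((A\to X)\to(B\to X)\to X)$, $\Diamond A := \forall X(\Box(A\to\blacksquare X)\to X)$, and the backward diamond $\Diamond^{\bullet} A := \forall X(\blacksquare(A\to\Box X)\to X)$. $\mathsf{IKt}2$ is axiomatised by: second-order intuitionistic propositional logic (axioms $A\to B\to A$; $(A\to B\to C)\to(A\to B)\to A\to C$; $\forall X(A\to B)\to\forall XA\to\forall XB$; $A\to\forall XA$ for $X\notin\mathrm{fv}(A)$; full comprehension $\forall XA\to A[C/X]$ for any formula $C$; rules modus ponens and generalisation: from $A[P/X]$ infer $\forall XA$ for $P$ fresh); distribution $\Box(A\to B)\to\Box A\to\Box B$, $\Box(A\to B)\to\Diamond A\to\Diamond B$, $\blacksquare(A\to B)\to\blacksquare A\to\blacksquare B$, $\blacksquare(A\to B)\to\Diamond^{\bullet} A\to\Diamond^{\bullet} B$; necessitation rules from $A$ infer $\Box A$ and from $A$ infer $\blacksquare A$; tense axioms $\Diamond^{\bullet}\Box A\to A$, $A\to\Box\Diamond^{\bullet}A$, $\Diamond\blacksquare A\to A$, $A\to\blacksquare\Diamond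 A$. A birelational structure $\mathfrak{B}$ consists of a set $W$ of worlds, a partial order $\le$ on $W$, a class $\mathcal{W}\subseteq\mathcal{P}(W)$ of $\le$-upward-closed sets, an interpretation $P_{\mathfrak{B}}\in\mathcal{W}$ of each propositional symbol, and an accessibility relation $R\subseteq W\times W$ that is a bisimulation for $\le$ (if $vRw\le w'$ then $v\le v'Rw'$ for some $v'$; if $v'\ge vRw$ then $v'Rw'$ for some $w'\ge w$). Satisfaction for closed formulas (treating each $V\in\mathcal{W}$ as a propositional symbol interpreted by itself): $v\models P$ iff $v\in P_{\mathfrak{B}}$; $v\models A\to B$ iff for all $v'\ge v$, $v'\models A$ implies $v'\models B$; $v\models\Box A$ iff for all $v'\ge v$ and $v'Rw'$, $w'\models A$; $v\models\blacksquare A$ iff for all $v'\ge v$ and $u'Rv'$, $u'\models A$; $v\models\forall XA$ iff for all $v'\ge v$ and $V\in\mathcal{W}$, $v'\models A[V/X]$. A birelational model is a comprehensive structure: for every closed formula $C$ of the expanded language, $\{w\in W : w\models C\}\in\mathcal{W}$. -}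

module Defs where

open import Level using (Level) renaming (suc to lsuc)
open import Data.Nat using (ℕ; zero; suc)
open import Data.Fin using (Fin; zero; suc)
open import Data.Product using (Σ; ∃; _×_; _,_)
open import Data.Unit using (⊤)
open import Relation.Nullary using (¬_)
open import Relation.Binary.PropositionalEquality using (_≡_)
open import Relation.Binary.Structures using (IsPartialOrder)
open import Function.Bundles using (_⇔_)

-- Syntax: formulas of IKt2 with at most n free second-order variables
-- (de Bruijn indices).  Propositional symbols are indexed by ℕ.

infixr 5 _⇒_

data Fm (n : ℕ) : Set where
  atom : ℕ → Fm n
  var  : Fin n → Fm n
  _⇒_  : Fm n → Fm n → Fm n
  □    : Fm n → Fm n
  ■    : Fm n → Fm n
  all  : Fm (suc n) → Fm n

liftR : ∀ {m n} → (Fin m → Fin n) → Fin (suc m) → Fin (suc n)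
liftR ρ zero    = zero
liftR ρ (suc i) = suc (ρ i)

ren : ∀ {m n} → (Fin m → Fin n) → Fm m → Fm n
ren ρ (atom p) = atom p
ren ρ (var i)  = var (ρ i)
ren ρ (A ⇒ B)  = ren ρ A ⇒ ren ρ B
ren ρ (□ A)    = □ (ren ρ A)
ren ρ (■ A)    = ■ (ren ρ A)
ren ρ (all A)  = all (ren (liftR ρ) A)

wk : ∀ {n} → Fm n → Fm (suc n)
wk = ren suc

liftS : ∀ {m n} → (Fin m → Fm n) → Fin (suc m) → Fm (suc n)
liftS σ zero    = var zero
liftS σ (suc i) = wk (σ i)

sub : ∀ {m n} → (Fin m → Fm n) → Fm m → Fm n
sub σ (atom p) = atom p
sub σ (var i)  = σ i
sub σ (A ⇒ B)  = sub σ A ⇒ sub σ B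
sub σ (□ A)    = □ (sub σ A)
sub σ (■ A)    = ■ (sub σ A)
sub σ (all A)  = all (sub (liftS σ) A)

single : ∀ {n} → Fm n → Fin (suc n) → Fm n
single C zero    = C
single C (suc i) = var i

_[_] : ∀ {n} → Fm (suc n) → Fm n → Fm n
A [ C ] = sub (single C) A

Fresh : ∀ {n} → ℕ → Fm n → Set
Fresh p (atom q) = ¬ (p ≡ q)
Fresh p (var i)  = ⊤
Fresh p (A ⇒ B)  = Fresh p A × Fresh p B
Fresh p (□ A)    = Fresh p A
Fresh p (■ A)    = Fresh p A
Fresh p (all A)  = Fresh p A

◇ : ∀ {n} → Fm n → Fm n
◇ A = all (□ (wk A ⇒ ■ (var zero)) ⇒ var zero)

◆ : ∀ {n} → Fm n → Fm n
◆ A = all (■ (wk A ⇒ □ (var zero)) ⇒ var zero)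

data Prf : ∀ {n} → Fm n → Set where
  ax-K    : ∀ {n} (A B : Fm n) → Prf (A ⇒ B ⇒ A)
  ax-S    : ∀ {n} (A B C : Fm n) → Prf ((A ⇒ B ⇒ C) ⇒ (A ⇒ B) ⇒ A ⇒ C)
  ax-∀K   : ∀ {n} (A B : Fm (suc n)) → Prf (all (A ⇒ B) ⇒ all A ⇒ all B)
  ax-vac  : ∀ {n} (A : Fm n) → Prf (A ⇒ all (wk A))
  ax-comp : ∀ {n} (A : Fm (suc n)) (C : Fm n) → Prf (all A ⇒ A [ C ])
  mp      : ∀ {n} {A B : Fm n} → Prf (A ⇒ B) → Prf A → Prf B
  gen     : ∀ {n} (A : Fm (suc n)) (p : ℕ) → Fresh p A → Prf (A [ atom p ]) → Prf (all A)
  ax-□K   : ∀ {n} (A B : Fm n) → Prf (□ (A ⇒ B) ⇒ □ A ⇒ □ B)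
  ax-◇K   : ∀ {n} (A B : Fm n) → Prf (□ (A ⇒ B) ⇒ ◇ A ⇒ ◇ B)
  ax-■K   : ∀ {n} (A B : Fm n) → Prf (■ (A ⇒ B) ⇒ ■ A ⇒ ■ B)
  ax-◆K   : ∀ {n} (A B : Fm n) → Prf (■ (A ⇒ B) ⇒ ◆ A ⇒ ◆ B)
  nec-□   : ∀ {n} {A : Fm n} → Prf A → Prf (□ A)
  nec-■   : ∀ {n} {A : Fm n} → Prf A → Prf (■ A)
  ax-t1   : ∀ {n} (A : Fm n) → Prf (◆ (□ A) ⇒ A)
  ax-t2   : ∀ {n} (A : Fm n) → Prf (A ⇒ □ (◆ A))
  ax-t3   : ∀ {n} (A : Fm n) → Prf (◇ (■ A) ⇒ A)
  ax-t4   : ∀ {n} (A : Fm n) → Prf (A ⇒ ■ (◇ A))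

-- Birelational structures.  The class 𝒲 of admissible sets is given as
-- a family of subsets (predicates) of W indexed by a type I.

record Birel (ℓ : Level) : Set (lsuc ℓ) where
  field
    W      : Set ℓ
    _≤_    : W → W → Set ℓ
    ≤-po   : IsPartialOrder _≡_ _≤_
    I      : Set ℓ
    mem    : I → W → Set ℓ
    upward : ∀ i {v v'} → v ≤ v' → mem i v → mem i v'
    interp : ℕ → I
    R      : W → W → Set ℓ
    bisim₁ : ∀ {v w w'} → R v w → w ≤ w' → ∃ λ v' → v ≤ v' × R v' w'
    bisim₂ : ∀ {v v' w} → v ≤ v' → R v w → ∃ λ w' → w ≤ w' × R v' w'

  -- satisfaction; the environment ρ assigns members of 𝒲 to the free
  -- variables (i.e. a formula of the expanded language)
  Env : ℕ → Set ℓ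
  Env n = Fin n → I

  extend : ∀ {n} → I → Env n → Env (suc n)
  extend i ρ zero    = i
  extend i ρ (suc x) = ρ x

  sat : ∀ {n} → Fm n → Env n → W → Set ℓ
  sat (atom p) ρ v = mem (interp p) v
  sat (var x)  ρ v = mem (ρ x) v
  sat (A ⇒ B)  ρ v = ∀ v' → v ≤ v' → sat A ρ v' → sat B ρ v'
  sat (□ A)    ρ v = ∀ v' w' → v ≤ v' → R v' w' → sat A ρ w'
  sat (■ A)    ρ v = ∀ v' u' → v ≤ v' → R u' v' → sat A ρ u'
  sat (all A)  ρ v = ∀ v' → v ≤ v' → ∀ (i : I) → sat A (extend i ρ) v'

  Comprehensive : Set ℓ
  Comprehensive = ∀ {n} (C : Fm n) (ρ : Env n) →
                  ∃ λ (i : I) → ∀ w → mem i w ⇔ sat C ρ w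

  closedEnv : Env 0
  closedEnv ()

  Valid : Fm 0 → Set ℓ
  Valid A = ∀ w → sat A closedEnv w

record Model (ℓ : Level) : Set (lsuc ℓ) where
  field
    structure     : Birel ℓ
    comprehensive : Birel.Comprehensive structure

_⊨_ : ∀ {ℓ} → Model ℓ → Fm 0 → Set ℓ
𝔅 ⊨ A = Birel.Valid (Model.structure 𝔅) A

-- For the generalisation rule the
-- fresh symbol p is reinterpreted as an arbitrary member of 𝒲; the modified
-- structure is again comprehensive because a formula mentioning p there means
-- what the formula with p abstracted to a variable means in the original one.
--
-- Completeness uses a canonical model whose worlds are closed formulas, with
-- F ≤ G when G is syntactically F ∧ X₁ ∧ … ∧ Xₖ (so that ≤ is antisymmetric),
-- admissible sets {G ∣ ⊢ G → C}, and F R G iff ⊢ G → ◆F and ⊢ F → ◇G.  The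
-- tense axioms provide both bisimulation witnesses (F ∧ ◇G′ and G ∧ ◆F′) and the □, ■ cases of the truth lemma
-- "G ⊨ C iff ⊢ G → C".  The truth lemma makes the model comprehensive, and a
-- formula valid in it holds at the world p₀ → p₀, hence is provable.
module Submission where

open import Defs
open import Level using (Level; Lift; lift; lower)
open import Function.Bundles using (_⇔_; mk⇔; Equivalence)
open import Function.Related.TypeIsomorphisms using (→-cong-⇔)
open import Function.Properties.Equivalence using ()
  renaming (refl to ⇔-refl; sym to ⇔-sym; trans to ⇔-trans)
open import Data.Nat using (ℕ; zero; suc; _⊔_; _+_; _≟_; s≤s)
  renaming (_≤_ to _≤ℕ_; _<_ to _<ℕ_)
open import Data.Nat.Properties
  using (m≤m⊔n; m≤n⊔m; ≤-<-trans; <-irrefl; ≤-refl; ≤-trans; <-≤-trans; m≤m+n; n≤1+n; <⇒≤)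
open import Data.Fin using (Fin; zero; suc)
open import Data.Product using (_×_; _,_; proj₁; proj₂)
open import Data.Unit using (tt)
open import Data.Empty using (⊥-elim)
open import Relation.Nullary using (Dec; yes; no)
open import Relation.Binary.PropositionalEquality
  using (_≡_; refl; sym; trans; cong; cong₂; subst; isEquivalence)
open import Relation.Binary.Structures using (IsPartialOrder)

open Equivalence using (to; from)

∀-cong : ∀ {a b c} {A : Set a} {P : A → Set b} {Q : A → Set c} →
         (∀ x → P x ⇔ Q x) → (∀ x → P x) ⇔ (∀ x → Q x)
∀-cong e = mk⇔ (λ f x → to (e x) (f x)) (λ g x → from (e x) (g x))

-- Renaming and substitution

liftR-cong : ∀ {m n} {r r' : Fin m → Fin n} → (∀ x → r x ≡ r' x) →
             ∀ x → liftR r x ≡ liftR r' x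
liftR-cong e zero    = refl
liftR-cong e (suc x) = cong suc (e x)

ren-cong : ∀ {m n} {r r' : Fin m → Fin n} → (∀ x → r x ≡ r' x) → ∀ A → ren r A ≡ ren r' A
ren-cong e (atom p) = refl
ren-cong e (var x)  = cong var (e x)
ren-cong e (A ⇒ B)  = cong₂ _⇒_ (ren-cong e A) (ren-cong e B)
ren-cong e (□ A)    = cong □ (ren-cong e A)
ren-cong e (■ A)    = cong ■ (ren-cong e A)
ren-cong e (all A)  = cong all (ren-cong (liftR-cong e) A)

ren-ren : ∀ {l m n} (r : Fin m → Fin n) (r' : Fin l → Fin m) A →
          ren r (ren r' A) ≡ ren (λ x → r (r' x)) A
ren-ren r r' (atom p) = refl
ren-ren r r' (var x)  = refl
ren-ren r r' (A ⇒ B)  = cong₂ _⇒_ (ren-ren r r' A) (ren-ren r r' B)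
ren-ren r r' (□ A)    = cong □ (ren-ren r r' A)
ren-ren r r' (■ A)    = cong ■ (ren-ren r r' A)
ren-ren r r' (all A)  = cong all (trans (ren-ren (liftR r) (liftR r') A) (ren-cong lift-∘ A))
  where
  lift-∘ : ∀ x → liftR r (liftR r' x) ≡ liftR (λ x → r (r' x)) x
  lift-∘ zero    = refl
  lift-∘ (suc x) = refl

liftS-cong : ∀ {m n} {σ τ : Fin m → Fm n} → (∀ x → σ x ≡ τ x) →
             ∀ x → liftS σ x ≡ liftS τ x
liftS-cong e zero    = refl
liftS-cong e (suc x) = cong wk (e x)

sub-cong : ∀ {m n} {σ τ : Fin m → Fm n} → (∀ x → σ x ≡ τ x) → ∀ A → sub σ A ≡ sub τ A
sub-cong e (atom p) = refl
sub-cong e (var x)  = e x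
sub-cong e (A ⇒ B)  = cong₂ _⇒_ (sub-cong e A) (sub-cong e B)
sub-cong e (□ A)    = cong □ (sub-cong e A)
sub-cong e (■ A)    = cong ■ (sub-cong e A)
sub-cong e (all A)  = cong all (sub-cong (liftS-cong e) A)

sub-ren : ∀ {l m n} (σ : Fin m → Fm n) (r : Fin l → Fin m) A →
          sub σ (ren r A) ≡ sub (λ x → σ (r x)) A
sub-ren σ r (atom p) = refl
sub-ren σ r (var x)  = refl
sub-ren σ r (A ⇒ B)  = cong₂ _⇒_ (sub-ren σ r A) (sub-ren σ r B)
sub-ren σ r (□ A)    = cong □ (sub-ren σ r A)
sub-ren σ r (■ A)    = cong ■ (sub-ren σ r A)
sub-ren σ r (all A)  = cong all (trans (sub-ren (liftS σ) (liftR r) A) (sub-cong lift-∘ A))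
  where
  lift-∘ : ∀ x → liftS σ (liftR r x) ≡ liftS (λ x → σ (r x)) x
  lift-∘ zero    = refl
  lift-∘ (suc x) = refl

ren-sub : ∀ {l m n} (r : Fin m → Fin n) (σ : Fin l → Fm m) A →
          ren r (sub σ A) ≡ sub (λ x → ren r (σ x)) A
ren-sub r σ (atom p) = refl
ren-sub r σ (var x)  = refl
ren-sub r σ (A ⇒ B)  = cong₂ _⇒_ (ren-sub r σ A) (ren-sub r σ B)
ren-sub r σ (□ A)    = cong □ (ren-sub r σ A)
ren-sub r σ (■ A)    = cong ■ (ren-sub r σ A)
ren-sub r σ (all A)  = cong all (trans (ren-sub (liftR r) (liftS σ) A) (sub-cong lift-∘ A))
  where
  lift-∘ : ∀ x → ren (liftR r) (liftS σ x) ≡ liftS (λ x → ren r (σ x)) x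
  lift-∘ zero    = refl
  lift-∘ (suc x) = trans (ren-ren (liftR r) suc (σ x)) (sym (ren-ren suc r (σ x)))

sub-sub : ∀ {l m n} (τ : Fin m → Fm n) (σ : Fin l → Fm m) A →
          sub τ (sub σ A) ≡ sub (λ x → sub τ (σ x)) A
sub-sub τ σ (atom p) = refl
sub-sub τ σ (var x)  = refl
sub-sub τ σ (A ⇒ B)  = cong₂ _⇒_ (sub-sub τ σ A) (sub-sub τ σ B)
sub-sub τ σ (□ A)    = cong □ (sub-sub τ σ A)
sub-sub τ σ (■ A)    = cong ■ (sub-sub τ σ A)
sub-sub τ σ (all A)  = cong all (trans (sub-sub (liftS τ) (liftS σ) A) (sub-cong lift-∘ A))
  where
  lift-∘ : ∀ x → sub (liftS τ) (liftS σ x) ≡ liftS (λ x → sub τ (σ x)) x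
  lift-∘ zero    = refl
  lift-∘ (suc x) = trans (sub-ren (liftS τ) suc (σ x)) (sym (ren-sub suc τ (σ x)))

sub-var : ∀ {n} (A : Fm n) → sub var A ≡ A
sub-var (atom p) = refl
sub-var (var x)  = refl
sub-var (A ⇒ B)  = cong₂ _⇒_ (sub-var A) (sub-var B)
sub-var (□ A)    = cong □ (sub-var A)
sub-var (■ A)    = cong ■ (sub-var A)
sub-var (all A)  = cong all (trans (sub-cong liftS-var A) (sub-var A))
  where
  liftS-var : ∀ x → liftS var x ≡ var x
  liftS-var zero    = refl
  liftS-var (suc x) = refl

wk-[] : ∀ {n} (A : Fm n) (C : Fm n) → wk A [ C ] ≡ A
wk-[] A C = trans (sub-ren (single C) suc A) (sub-var A)

-- Derived rules of IKt2

maxAtom : ∀ {n} → Fm n → ℕ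
maxAtom (atom q) = q
maxAtom (var _)  = 0
maxAtom (A ⇒ B)  = maxAtom A ⊔ maxAtom B
maxAtom (□ A)    = maxAtom A
maxAtom (■ A)    = maxAtom A
maxAtom (all A)  = maxAtom A

maxAtom<⇒Fresh : ∀ {n} (A : Fm n) {p} → maxAtom A <ℕ p → Fresh p A
maxAtom<⇒Fresh (atom q) h refl = <-irrefl refl h
maxAtom<⇒Fresh (var _)  h      = tt
maxAtom<⇒Fresh (A ⇒ B)  h = maxAtom<⇒Fresh A (≤-<-trans (m≤m⊔n _ _) h)
                          , maxAtom<⇒Fresh B (≤-<-trans (m≤n⊔m _ _) h)
maxAtom<⇒Fresh (□ A)    h = maxAtom<⇒Fresh A h
maxAtom<⇒Fresh (■ A)    h = maxAtom<⇒Fresh A h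
maxAtom<⇒Fresh (all A)  h = maxAtom<⇒Fresh A h

gen-∀ : ∀ {n} (A : Fm (suc n)) → (∀ p → Prf (A [ atom p ])) → Prf (all A)
gen-∀ A h = gen A (suc (maxAtom A)) (maxAtom<⇒Fresh A ≤-refl) (h (suc (maxAtom A)))

module _ {n : ℕ} where
  infixr 9 _∘ₚ_

  prf-id : {A : Fm n} → Prf (A ⇒ A)
  prf-id {A} = mp (mp (ax-S A (A ⇒ A) A) (ax-K A (A ⇒ A))) (ax-K A A)

  prf-const : {A B : Fm n} → Prf B → Prf (A ⇒ B)
  prf-const {A} {B} b = mp (ax-K B A) b

  prf-S : {A B C : Fm n} → Prf (A ⇒ B ⇒ C) → Prf (A ⇒ B) → Prf (A ⇒ C)
  prf-S f g = mp (mp (ax-S _ _ _) f) g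

  _∘ₚ_ : {A B C : Fm n} → Prf (B ⇒ C) → Prf (A ⇒ B) → Prf (A ⇒ C)
  g ∘ₚ f = prf-S (prf-const g) f

  prf-B : {A B C : Fm n} → Prf ((B ⇒ C) ⇒ (A ⇒ B) ⇒ A ⇒ C)
  prf-B {A} {B} {C} = ax-S A B C ∘ₚ ax-K (B ⇒ C) A

  ∘ₚ-under : {F A B C : Fm n} → Prf (F ⇒ B ⇒ C) → Prf (F ⇒ A ⇒ B) → Prf (F ⇒ A ⇒ C)
  ∘ₚ-under g f = prf-S (prf-S (prf-const prf-B) g) f

  prf-C : {A B C : Fm n} → Prf ((A ⇒ B ⇒ C) ⇒ B ⇒ A ⇒ C)
  prf-C {A} {B} {C} = ∘ₚ-under (ax-S A B C) (prf-const (ax-K B A))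

  prf-flip : {A B C : Fm n} → Prf (A ⇒ B ⇒ C) → Prf (B ⇒ A ⇒ C)
  prf-flip f = mp prf-C f

  prf-apply₂ : {A B C : Fm n} → Prf (A ⇒ B ⇒ (A ⇒ B ⇒ C) ⇒ C)
  prf-apply₂ = prf-C ∘ₚ prf-flip prf-id

infixr 6 _∧_

_∧_ : ∀ {n} → Fm n → Fm n → Fm n
A ∧ B = all ((wk A ⇒ wk B ⇒ var zero) ⇒ var zero)

module _ {n : ℕ} where
  ∧-intro : {A B : Fm n} → Prf (A ⇒ B ⇒ A ∧ B)
  ∧-intro {A} {B} = ∘ₚ-under (ax-∀K (wk B) G ∘ₚ (distrib ∘ₚ ax-vac A)) (prf-const (ax-vac B))
    where
    G : Fm (suc n)
    G = (wk A ⇒ wk B ⇒ var zero) ⇒ var zero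
    distrib : Prf (all (wk A) ⇒ all (wk B ⇒ G))
    distrib = mp (ax-∀K (wk A) (wk B ⇒ G)) (gen-∀ _ (λ _ → prf-apply₂))

  ∧-elim : {A B C : Fm n} → Prf (A ∧ B ⇒ (A ⇒ B ⇒ C) ⇒ C)
  ∧-elim {A} {B} {C} =
    subst (λ D → Prf (A ∧ B ⇒ D)) (cong₂ (λ a b → (a ⇒ b ⇒ C) ⇒ C) (wk-[] A C) (wk-[] B C))
      (ax-comp ((wk A ⇒ wk B ⇒ var zero) ⇒ var zero) C)

  ∧-elim₁ : {A B : Fm n} → Prf (A ∧ B ⇒ A)
  ∧-elim₁ {A} {B} = prf-S ∧-elim (prf-const (ax-K A B))

  ∧-elim₂ : {A B : Fm n} → Prf (A ∧ B ⇒ B)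
  ∧-elim₂ = prf-S ∧-elim (prf-const (prf-const prf-id))

  curry : {F A B : Fm n} → Prf (F ∧ A ⇒ B) → Prf (F ⇒ A ⇒ B)
  curry h = ∘ₚ-under (prf-const h) ∧-intro

  □-mono : {A B : Fm n} → Prf (A ⇒ B) → Prf (□ A ⇒ □ B)
  □-mono f = mp (ax-□K _ _) (nec-□ f)

  ■-mono : {A B : Fm n} → Prf (A ⇒ B) → Prf (■ A ⇒ ■ B)
  ■-mono f = mp (ax-■K _ _) (nec-■ f)

  ◇-mono : {A B : Fm n} → Prf (A ⇒ B) → Prf (◇ A ⇒ ◇ B)
  ◇-mono f = mp (ax-◇K _ _) (nec-□ f)

  ◆-mono : {A B : Fm n} → Prf (A ⇒ B) → Prf (◆ A ⇒ ◆ B)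
  ◆-mono f = mp (ax-◆K _ _) (nec-■ f)

  ◆-∧◇ : {H G : Fm n} → Prf (H ⇒ ◆ G ⇒ ◆ (G ∧ ◇ H))
  ◆-∧◇ {H} {G} = ax-◆K G (G ∧ ◇ H) ∘ₚ (■-mono (prf-flip ∧-intro) ∘ₚ ax-t4 H)

  ◇-∧◆ : {H G : Fm n} → Prf (H ⇒ ◇ G ⇒ ◇ (G ∧ ◆ H))
  ◇-∧◆ {H} {G} = ax-◇K G (G ∧ ◆ H) ∘ₚ (□-mono (prf-flip ∧-intro) ∘ₚ ax-t2 H)

-- Semantics

module Semantics {ℓ} (B : Birel ℓ) where
  open Birel B
  open IsPartialOrder ≤-po public using () renaming (refl to ≤ʷ-refl; trans to ≤ʷ-trans)

  mem-cong : ∀ {i j} → i ≡ j → ∀ w → mem i w ⇔ mem j w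
  mem-cong refl w = ⇔-refl

  sat-mono : ∀ {n} (A : Fm n) ρ {v v'} → v ≤ v' → sat A ρ v → sat A ρ v'
  sat-mono (atom p) ρ le s = upward _ le s
  sat-mono (var x)  ρ le s = upward _ le s
  sat-mono (A ⇒ B)  ρ le s = λ v'' le' → s v'' (≤ʷ-trans le le')
  sat-mono (□ A)    ρ le s = λ v'' w le' → s v'' w (≤ʷ-trans le le')
  sat-mono (■ A)    ρ le s = λ v'' u le' → s v'' u (≤ʷ-trans le le')
  sat-mono (all A)  ρ le s = λ v'' le' → s v'' (≤ʷ-trans le le')

  sat-ren : ∀ {m n} (r : Fin m → Fin n) (ρ : Env n) (ρ' : Env m) → (∀ x → ρ' x ≡ ρ (r x)) →
            ∀ A w → sat (ren r A) ρ w ⇔ sat A ρ' w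
  sat-ren r ρ ρ' e (atom p) w = ⇔-refl
  sat-ren r ρ ρ' e (var x)  w = mem-cong (sym (e x)) w
  sat-ren r ρ ρ' e (A ⇒ B)  w =
    ∀-cong λ v' → ∀-cong λ _ → →-cong-⇔ (sat-ren r ρ ρ' e A v') (sat-ren r ρ ρ' e B v')
  sat-ren r ρ ρ' e (□ A)    w =
    ∀-cong λ _ → ∀-cong λ w' → ∀-cong λ _ → ∀-cong λ _ → sat-ren r ρ ρ' e A w'
  sat-ren r ρ ρ' e (■ A)    w =
    ∀-cong λ _ → ∀-cong λ u' → ∀-cong λ _ → ∀-cong λ _ → sat-ren r ρ ρ' e A u'
  sat-ren r ρ ρ' e (all A)  w =
    ∀-cong λ v' → ∀-cong λ _ → ∀-cong λ i →
      sat-ren (liftR r) (extend i ρ) (extend i ρ') (e↑ i) A v'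
    where
    e↑ : ∀ i x → extend i ρ' x ≡ extend i ρ (liftR r x)
    e↑ i zero    = refl
    e↑ i (suc x) = e x

  sat-wk : ∀ {n} (A : Fm n) ρ i w → sat (wk A) (extend i ρ) w ⇔ sat A ρ w
  sat-wk A ρ i w = sat-ren suc (extend i ρ) ρ (λ _ → refl) A w

  sat-sub : ∀ {m n} (σ : Fin m → Fm n) (ρ : Env n) (ρ' : Env m) →
            (∀ x w → mem (ρ' x) w ⇔ sat (σ x) ρ w) →
            ∀ A w → sat (sub σ A) ρ w ⇔ sat A ρ' w
  sat-sub σ ρ ρ' e (atom p) w = ⇔-refl
  sat-sub σ ρ ρ' e (var x)  w = ⇔-sym (e x w)
  sat-sub σ ρ ρ' e (A ⇒ B)  w =
    ∀-cong λ v' → ∀-cong λ _ → →-cong-⇔ (sat-sub σ ρ ρ' e A v') (sat-sub σ ρ ρ' e B v')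
  sat-sub σ ρ ρ' e (□ A)    w =
    ∀-cong λ _ → ∀-cong λ w' → ∀-cong λ _ → ∀-cong λ _ → sat-sub σ ρ ρ' e A w'
  sat-sub σ ρ ρ' e (■ A)    w =
    ∀-cong λ _ → ∀-cong λ u' → ∀-cong λ _ → ∀-cong λ _ → sat-sub σ ρ ρ' e A u'
  sat-sub σ ρ ρ' e (all A)  w =
    ∀-cong λ v' → ∀-cong λ _ → ∀-cong λ i →
      sat-sub (liftS σ) (extend i ρ) (extend i ρ') (e↑ i) A v'
    where
    e↑ : ∀ i x w → mem (extend i ρ' x) w ⇔ sat (liftS σ x) (extend i ρ) w
    e↑ i zero    w = ⇔-refl
    e↑ i (suc x) w = ⇔-trans (e x w) (⇔-sym (sat-wk (σ x) ρ i w))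

  sat-[] : ∀ {n} (A : Fm (suc n)) (C : Fm n) ρ i → (∀ w → mem i w ⇔ sat C ρ w) →
           ∀ w → sat (A [ C ]) ρ w ⇔ sat A (extend i ρ) w
  sat-[] A C ρ i e = sat-sub (single C) ρ (extend i ρ) e↑ A
    where
    e↑ : ∀ x w → mem (extend i ρ x) w ⇔ sat (single C x) ρ w
    e↑ zero    w = e w
    e↑ (suc x) w = ⇔-refl

module Reinterpret {ℓ} (B : Birel ℓ) (p : ℕ) (i : Birel.I B) where
  open Birel B
  open Semantics B

  reinterp : ∀ {q} → Dec (p ≡ q) → I
  reinterp     (yes _) = i
  reinterp {q} (no _)  = interp q

  B[p≔i] : Birel ℓ
  B[p≔i] = record B { interp = λ q → reinterp (p ≟ q) }

  atom↦var : ∀ {m q} → Fin m → Dec (p ≡ q) → Fm m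
  atom↦var         k (yes _) = var k
  atom↦var {q = q} k (no _)  = atom q

  bind-p : ∀ {n m} → (Fin n → Fin m) → Fin m → Fm n → Fm m
  bind-p r k (atom q) = atom↦var k (p ≟ q)
  bind-p r k (var x)  = var (r x)
  bind-p r k (A ⇒ C)  = bind-p r k A ⇒ bind-p r k C
  bind-p r k (□ A)    = □ (bind-p r k A)
  bind-p r k (■ A)    = ■ (bind-p r k A)
  bind-p r k (all A)  = all (bind-p (liftR r) (suc k) A)

  bind-p-fresh : ∀ {n m} (r : Fin n → Fin m) k (A : Fm n) → Fresh p A → bind-p r k A ≡ ren r A
  bind-p-fresh r k (atom q) fr with p ≟ q
  ... | yes p≡q = ⊥-elim (fr p≡q)
  ... | no _    = refl
  bind-p-fresh r k (var x)  fr       = refl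
  bind-p-fresh r k (A ⇒ C)  (fA , fC) = cong₂ _⇒_ (bind-p-fresh r k A fA) (bind-p-fresh r k C fC)
  bind-p-fresh r k (□ A)    fr       = cong □ (bind-p-fresh r k A fr)
  bind-p-fresh r k (■ A)    fr       = cong ■ (bind-p-fresh r k A fr)
  bind-p-fresh r k (all A)  fr       = cong all (bind-p-fresh (liftR r) (suc k) A fr)

  sat-atom↦var : ∀ {m q} (k : Fin m) (ρ : Env m) → ρ k ≡ i → (d : Dec (p ≡ q)) →
                 ∀ w → mem (reinterp d) w ⇔ sat (atom↦var k d) ρ w
  sat-atom↦var k ρ ρk≡i (yes _) w = mem-cong (sym ρk≡i) w
  sat-atom↦var k ρ ρk≡i (no _)  w = ⇔-refl

  sat-bind-p : ∀ {n m} (A : Fm n) (r : Fin n → Fin m) (k : Fin m) (ρ : Env n) (ρ' : Env m) →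
               (∀ x → ρ' (r x) ≡ ρ x) → ρ' k ≡ i →
               ∀ w → Birel.sat B[p≔i] A ρ w ⇔ sat (bind-p r k A) ρ' w
  sat-bind-p (atom q) r k ρ ρ' e ek w = sat-atom↦var k ρ' ek (p ≟ q) w
  sat-bind-p (var x)  r k ρ ρ' e ek w = mem-cong (sym (e x)) w
  sat-bind-p (A ⇒ C)  r k ρ ρ' e ek w =
    ∀-cong λ v' → ∀-cong λ _ →
      →-cong-⇔ (sat-bind-p A r k ρ ρ' e ek v') (sat-bind-p C r k ρ ρ' e ek v')
  sat-bind-p (□ A)    r k ρ ρ' e ek w =
    ∀-cong λ _ → ∀-cong λ w' → ∀-cong λ _ → ∀-cong λ _ → sat-bind-p A r k ρ ρ' e ek w'
  sat-bind-p (■ A)    r k ρ ρ' e ek w =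
    ∀-cong λ _ → ∀-cong λ u' → ∀-cong λ _ → ∀-cong λ _ → sat-bind-p A r k ρ ρ' e ek u'
  sat-bind-p (all A)  r k ρ ρ' e ek w =
    ∀-cong λ v' → ∀-cong λ _ → ∀-cong λ j →
      sat-bind-p A (liftR r) (suc k) (Birel.extend B[p≔i] j ρ) (extend j ρ') (e↑ j) ek v'
    where
    e↑ : ∀ j x → extend j ρ' (liftR r x) ≡ Birel.extend B[p≔i] j ρ x
    e↑ j zero    = refl
    e↑ j (suc x) = e x

  comprehensive-B[p≔i] : Comprehensive → Birel.Comprehensive B[p≔i]
  comprehensive-B[p≔i] comp C ρ with comp (bind-p suc zero C) (extend i ρ)
  ... | j , h = j , λ w →
    ⇔-trans (h w) (⇔-sym (sat-bind-p C suc zero ρ (extend i ρ) (λ _ → refl) refl w))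

  sat-fresh-instance : ∀ {n} (A : Fm (suc n)) → Fresh p A → (ρ : Env n) →
                       ∀ w → Birel.sat B[p≔i] (A [ atom p ]) ρ w ⇔ sat A (extend i ρ) w
  sat-fresh-instance A fr ρ w =
    ⇔-trans instance-p (⇔-trans bound (subst (λ D → sat D ρ₂ w ⇔ sat A (extend i ρ) w) wk≡bind weaken))
    where
    ρ₁ : Env (suc _)
    ρ₁ = Birel.extend B[p≔i] i ρ
    ρ₂ : Env (suc (suc _))
    ρ₂ = extend i (extend i ρ)
    mem-i : ∀ w → mem i w ⇔ mem (reinterp (p ≟ p)) w
    mem-i w with p ≟ p
    ... | yes _  = ⇔-refl
    ... | no p≢p = ⊥-elim (p≢p refl)
    instance-p : Birel.sat B[p≔i] (A [ atom p ]) ρ w ⇔ Birel.sat B[p≔i] A ρ₁ w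
    instance-p = Semantics.sat-[] B[p≔i] A (atom p) ρ i mem-i w
    -- Birel.extend B[p≔i] and Birel.extend B agree only pointwise, not definitionally.
    ρ₁-agrees : ∀ x → ρ₂ (suc x) ≡ ρ₁ x
    ρ₁-agrees zero    = refl
    ρ₁-agrees (suc x) = refl
    bound : Birel.sat B[p≔i] A ρ₁ w ⇔ sat (bind-p suc zero A) ρ₂ w
    bound = sat-bind-p A suc zero ρ₁ ρ₂ ρ₁-agrees refl w
    wk≡bind : wk A ≡ bind-p suc zero A
    wk≡bind = sym (bind-p-fresh suc zero A fr)
    weaken : sat (wk A) ρ₂ w ⇔ sat A (extend i ρ) w
    weaken = sat-wk A (extend i ρ) i w

-- Soundness

module Axioms {ℓ} (M : Model ℓ) where
  open Model M
  open Birel structure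
  open Semantics structure

  sat-K : ∀ {n} (A B : Fm n) ρ w → sat (A ⇒ B ⇒ A) ρ w
  sat-K A B ρ w _ _ a _ le _ = sat-mono A ρ le a

  sat-S : ∀ {n} (A B C : Fm n) ρ w → sat ((A ⇒ B ⇒ C) ⇒ (A ⇒ B) ⇒ A ⇒ C) ρ w
  sat-S A B C ρ w _ _ f _ le₂ g v₃ le₃ a =
    f v₃ (≤ʷ-trans le₂ le₃) a v₃ ≤ʷ-refl (g v₃ le₃ a)

  sat-∀K : ∀ {n} (A B : Fm (suc n)) ρ w → sat (all (A ⇒ B) ⇒ all A ⇒ all B) ρ w
  sat-∀K A B ρ w _ _ f _ le₂ g v₃ le₃ i =
    f v₃ (≤ʷ-trans le₂ le₃) i v₃ ≤ʷ-refl (g v₃ le₃ i)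

  sat-vac : ∀ {n} (A : Fm n) ρ w → sat (A ⇒ all (wk A)) ρ w
  sat-vac A ρ w _ _ a v₂ le i = from (sat-wk A ρ i v₂) (sat-mono A ρ le a)

  sat-comp : ∀ {n} (A : Fm (suc n)) (C : Fm n) ρ w → sat (all A ⇒ A [ C ]) ρ w
  sat-comp A C ρ w v₁ _ h with comprehensive C ρ
  ... | j , e = from (sat-[] A C ρ j e v₁) (h v₁ ≤ʷ-refl j)

  sat-□K : ∀ {n} (A B : Fm n) ρ w → sat (□ (A ⇒ B) ⇒ □ A ⇒ □ B) ρ w
  sat-□K A B ρ w _ _ f _ le₂ g v₃ w₃ le₃ r =
    f v₃ w₃ (≤ʷ-trans le₂ le₃) r w₃ ≤ʷ-refl (g v₃ w₃ le₃ r)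

  sat-■K : ∀ {n} (A B : Fm n) ρ w → sat (■ (A ⇒ B) ⇒ ■ A ⇒ ■ B) ρ w
  sat-■K A B ρ w _ _ f _ le₂ g v₃ u₃ le₃ r =
    f v₃ u₃ (≤ʷ-trans le₂ le₃) r u₃ ≤ʷ-refl (g v₃ u₃ le₃ r)

  sat-◇K : ∀ {n} (A B : Fm n) ρ w → sat (□ (A ⇒ B) ⇒ ◇ A ⇒ ◇ B) ρ w
  sat-◇K A B ρ w _ _ f _ le₂ g v₃ le₃ i v₄ le₄ h =
    g v₄ (≤ʷ-trans le₃ le₄) i v₄ ≤ʷ-refl λ v₅ w₅ le₅ r₅ w₆ le₆ a →
      h v₅ w₅ le₅ r₅ w₆ le₆ (from (sat-wk B ρ i w₆)
        (f v₅ w₅ (≤ʷ-trans le₂ (≤ʷ-trans le₃ (≤ʷ-trans le₄ le₅))) r₅ w₆ le₆ (to (sat-wk A ρ i w₆) a)))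

  sat-◆K : ∀ {n} (A B : Fm n) ρ w → sat (■ (A ⇒ B) ⇒ ◆ A ⇒ ◆ B) ρ w
  sat-◆K A B ρ w _ _ f _ le₂ g v₃ le₃ i v₄ le₄ h =
    g v₄ (≤ʷ-trans le₃ le₄) i v₄ ≤ʷ-refl λ v₅ u₅ le₅ r₅ u₆ le₆ a →
      h v₅ u₅ le₅ r₅ u₆ le₆ (from (sat-wk B ρ i u₆)
        (f v₅ u₅ (≤ʷ-trans le₂ (≤ʷ-trans le₃ (≤ʷ-trans le₄ le₅))) r₅ u₆ le₆ (to (sat-wk A ρ i u₆) a)))

  -- Instantiating the bound variable of ◆ / ◇ with the set defined by A.
  sat-t1 : ∀ {n} (A : Fm n) ρ w → sat (◆ (□ A) ⇒ A) ρ w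
  sat-t1 A ρ w v₁ _ h with comprehensive A ρ
  ... | j , e = to (e v₁) (h v₁ ≤ʷ-refl j v₁ ≤ʷ-refl λ _ _ _ _ u₃ _ b u₄ w₄ le₄ r₄ →
                  from (e w₄) (to (sat-wk (□ A) ρ j u₃) b u₄ w₄ le₄ r₄))

  sat-t3 : ∀ {n} (A : Fm n) ρ w → sat (◇ (■ A) ⇒ A) ρ w
  sat-t3 A ρ w v₁ _ h with comprehensive A ρ
  ... | j , e = to (e v₁) (h v₁ ≤ʷ-refl j v₁ ≤ʷ-refl λ _ _ _ _ w₃ _ b v₄ u₄ le₄ r₄ →
                  from (e u₄) (to (sat-wk (■ A) ρ j w₃) b v₄ u₄ le₄ r₄))

  -- The bisimulation condition moves the R-step back below the ≤-larger world.
  sat-t2 : ∀ {n} (A : Fm n) ρ w → sat (A ⇒ □ (◆ A)) ρ w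
  sat-t2 A ρ w _ _ a _ w₂ le₂ r w₃ le₃ i w₄ le₄ h with bisim₁ r (≤ʷ-trans le₃ le₄)
  ... | v₄ , le , r₄ =
    h w₄ v₄ ≤ʷ-refl r₄ v₄ ≤ʷ-refl (from (sat-wk A ρ i v₄) (sat-mono A ρ (≤ʷ-trans le₂ le) a)) v₄ w₄ ≤ʷ-refl r₄

  sat-t4 : ∀ {n} (A : Fm n) ρ w → sat (A ⇒ ■ (◇ A)) ρ w
  sat-t4 A ρ w _ _ a _ u₂ le₂ r u₃ le₃ i u₄ le₄ h with bisim₂ (≤ʷ-trans le₃ le₄) r
  ... | v₄ , le , r₄ =
    h u₄ v₄ ≤ʷ-refl r₄ v₄ ≤ʷ-refl (from (sat-wk A ρ i v₄) (sat-mono A ρ (≤ʷ-trans le₂ le) a)) v₄ u₄ ≤ʷ-refl r₄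

reinterpret : ∀ {ℓ} (M : Model ℓ) (p : ℕ) (i : Birel.I (Model.structure M)) → Model ℓ
reinterpret M p i = record
  { structure     = Reinterpret.B[p≔i] (Model.structure M) p i
  ; comprehensive = Reinterpret.comprehensive-B[p≔i] (Model.structure M) p i (Model.comprehensive M)
  }

sound : ∀ {ℓ n} {A : Fm n} → Prf A → (M : Model ℓ) (ρ : Birel.Env (Model.structure M) n) →
        ∀ w → Birel.sat (Model.structure M) A ρ w
sound (ax-K A B)       M = Axioms.sat-K M A B
sound (ax-S A B C)     M = Axioms.sat-S M A B C
sound (ax-∀K A B)      M = Axioms.sat-∀K M A B
sound (ax-vac A)       M = Axioms.sat-vac M A
sound (ax-comp A C)    M = Axioms.sat-comp M A C
sound (mp d e)         M ρ w = sound d M ρ w w (Semantics.≤ʷ-refl (Model.structure M)) (sound e M ρ w)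
sound (gen A p fr d)   M ρ w v _ i =
  to (Reinterpret.sat-fresh-instance (Model.structure M) p i A fr ρ v) (sound d (reinterpret M p i) ρ v)
sound (ax-□K A B)      M = Axioms.sat-□K M A B
sound (ax-◇K A B)      M = Axioms.sat-◇K M A B
sound (ax-■K A B)      M = Axioms.sat-■K M A B
sound (ax-◆K A B)      M = Axioms.sat-◆K M A B
sound (nec-□ d)        M ρ w _ w' _ _ = sound d M ρ w'
sound (nec-■ d)        M ρ w _ u' _ _ = sound d M ρ u'
sound (ax-t1 A)        M = Axioms.sat-t1 M A
sound (ax-t2 A)        M = Axioms.sat-t2 M A
sound (ax-t3 A)        M = Axioms.sat-t3 M A
sound (ax-t4 A)        M = Axioms.sat-t4 M A

-- The canonical model

size : ∀ {n} → Fm n → ℕ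
size (atom _) = 1
size (var _)  = 1
size (A ⇒ B)  = suc (size A + size B)
size (□ A)    = suc (size A)
size (■ A)    = suc (size A)
size (all A)  = suc (size A)

size-ren : ∀ {m n} (r : Fin m → Fin n) A → size (ren r A) ≡ size A
size-ren r (atom _) = refl
size-ren r (var _)  = refl
size-ren r (A ⇒ B)  = cong₂ (λ a b → suc (a + b)) (size-ren r A) (size-ren r B)
size-ren r (□ A)    = cong suc (size-ren r A)
size-ren r (■ A)    = cong suc (size-ren r A)
size-ren r (all A)  = cong suc (size-ren (liftR r) A)

size<size-∧ : ∀ {n} (G X : Fm n) → size G <ℕ size (G ∧ X)
size<size-∧ G X rewrite size-ren suc G =
  s≤s (≤-trans (m≤m+n (size G) _) (≤-trans (n≤1+n _) (≤-trans (m≤m+n _ 1) (n≤1+n _))))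

infix 4 _≼_

data _≼_ (F : Fm 0) : Fm 0 → Set where
  ≼-refl : F ≼ F
  ≼-∧    : ∀ {G} X → F ≼ G → F ≼ G ∧ X

≼-trans : ∀ {F G H} → F ≼ G → G ≼ H → F ≼ H
≼-trans p ≼-refl    = p
≼-trans p (≼-∧ X q) = ≼-∧ X (≼-trans p q)

≼⇒size≤ : ∀ {F G} → F ≼ G → size F ≤ℕ size G
≼⇒size≤ ≼-refl    = ≤-refl
≼⇒size≤ (≼-∧ X p) = ≤-trans (≼⇒size≤ p) (<⇒≤ (size<size-∧ _ X))

≼-antisym : ∀ {F G} → F ≼ G → G ≼ F → F ≡ G
≼-antisym ≼-refl    _ = refl
≼-antisym (≼-∧ X p) q =
  ⊥-elim (<-irrefl refl (<-≤-trans (size<size-∧ _ X) (≤-trans (≼⇒size≤ q) (≼⇒size≤ p))))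

≼⇒prf : ∀ {F G} → F ≼ G → Prf (G ⇒ F)
≼⇒prf ≼-refl    = prf-id
≼⇒prf (≼-∧ X p) = ≼⇒prf p ∘ₚ ∧-elim₁

module Canonical (ℓ : Level) where
  World : Set ℓ
  World = Lift ℓ (Fm 0)

  _≤ᶜ_ : World → World → Set ℓ
  v ≤ᶜ w = Lift ℓ (lower v ≼ lower w)

  Rᶜ : World → World → Set ℓ
  Rᶜ v w = Lift ℓ (Prf (lower w ⇒ ◆ (lower v)) × Prf (lower v ⇒ ◇ (lower w)))

  ≤ᶜ-isPartialOrder : IsPartialOrder _≡_ _≤ᶜ_
  ≤ᶜ-isPartialOrder = record
    { isPreorder = record
      { isEquivalence = isEquivalence
      ; reflexive     = λ { refl → lift ≼-refl }
      ; trans         = λ p q → lift (≼-trans (lower p) (lower q))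
      }
    ; antisym = λ p q → cong lift (≼-antisym (lower p) (lower q))
    }

  Rᶜ-∧◇ : ∀ {F G} → Prf (G ⇒ ◆ F) → Rᶜ (lift (F ∧ ◇ G)) (lift G)
  Rᶜ-∧◇ G→◆F = lift (prf-S ◆-∧◇ G→◆F , ∧-elim₂)

  Rᶜ-∧◆ : ∀ {F G} → Prf (F ⇒ ◇ G) → Rᶜ (lift F) (lift (G ∧ ◆ F))
  Rᶜ-∧◆ F→◇G = lift (∧-elim₂ , prf-S ◇-∧◆ F→◇G)

  canonical : Birel ℓ
  canonical = record
    { W      = World
    ; _≤_    = _≤ᶜ_
    ; ≤-po   = ≤ᶜ-isPartialOrder
    ; I      = Lift ℓ (Fm 0)
    ; mem    = λ C F → Lift ℓ (Prf (lower F ⇒ lower C))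
    ; upward = λ C F≤G F⊢C → lift (lower F⊢C ∘ₚ ≼⇒prf (lower F≤G))
    ; interp = λ p → lift (atom p)
    ; R      = Rᶜ
    ; bisim₁ = λ {_} {_} {w'} r w≤w' →
        lift _ , lift (≼-∧ (◇ (lower w')) ≼-refl) , Rᶜ-∧◇ (proj₁ (lower r) ∘ₚ ≼⇒prf (lower w≤w'))
    ; bisim₂ = λ {_} {v'} v≤v' r →
        lift _ , lift (≼-∧ (◆ (lower v')) ≼-refl) , Rᶜ-∧◆ (proj₂ (lower r) ∘ₚ ≼⇒prf (lower v≤v'))
    }

  open Birel canonical using (sat; extend; Env; closedEnv; Comprehensive)

  ⌊_⌋ : ∀ {n} → Env n → Fin n → Fm 0
  ⌊ ρ ⌋ x = lower (ρ x)

  ⌊extend⌋ : ∀ {n} (A : Fm (suc n)) (C : Lift ℓ (Fm 0)) (ρ : Env n) →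
             sub ⌊ extend C ρ ⌋ A ≡ sub (liftS ⌊ ρ ⌋) A [ lower C ]
  ⌊extend⌋ A C ρ = trans (sub-cong pointwise A) (sym (sub-sub (single (lower C)) (liftS ⌊ ρ ⌋) A))
    where
    pointwise : ∀ x → ⌊ extend C ρ ⌋ x ≡ sub (single (lower C)) (liftS ⌊ ρ ⌋ x)
    pointwise zero    = refl
    pointwise (suc x) = sym (wk-[] (lower (ρ x)) (lower C))

  -- The intro directions test F ⇒ A at F ∧ A, □ A at the R-successor ◆ F of
  -- F ∧ ◇ ◆ F, and ■ A at the R-predecessor ◇ F of F ∧ ◆ ◇ F.
  truth : ∀ {n} (A : Fm n) (ρ : Env n) (F : Fm 0) → sat A ρ (lift F) ⇔ Prf (F ⇒ sub ⌊ ρ ⌋ A)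
  truth (atom p) ρ F = mk⇔ lower lift
  truth (var x)  ρ F = mk⇔ lower lift
  truth (A ⇒ B)  ρ F = mk⇔ intro elim
    where
    A' = sub ⌊ ρ ⌋ A
    intro : sat (A ⇒ B) ρ (lift F) → Prf (F ⇒ A' ⇒ sub ⌊ ρ ⌋ B)
    intro h = curry (to (truth B ρ (F ∧ A'))
                (h (lift (F ∧ A')) (lift (≼-∧ A' ≼-refl)) (from (truth A ρ (F ∧ A')) ∧-elim₂)))
    elim : Prf (F ⇒ A' ⇒ sub ⌊ ρ ⌋ B) → sat (A ⇒ B) ρ (lift F)
    elim d G F≤G a =
      from (truth B ρ (lower G)) (prf-S (d ∘ₚ ≼⇒prf (lower F≤G)) (to (truth A ρ (lower G)) a))
  truth (□ A)    ρ F = mk⇔ intro elim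
    where
    intro : sat (□ A) ρ (lift F) → Prf (F ⇒ □ (sub ⌊ ρ ⌋ A))
    intro h = □-mono (to (truth A ρ (◆ F))
                (h (lift (F ∧ ◇ (◆ F))) (lift (◆ F)) (lift (≼-∧ _ ≼-refl)) (Rᶜ-∧◇ prf-id)))
              ∘ₚ ax-t2 F
    elim : Prf (F ⇒ □ (sub ⌊ ρ ⌋ A)) → sat (□ A) ρ (lift F)
    elim d G H F≤G (lift (H→◆G , _)) =
      from (truth A ρ (lower H)) (ax-t1 _ ∘ₚ ◆-mono (d ∘ₚ ≼⇒prf (lower F≤G)) ∘ₚ H→◆G)
  truth (■ A)    ρ F = mk⇔ intro elim
    where
    intro : sat (■ A) ρ (lift F) → Prf (F ⇒ ■ (sub ⌊ ρ ⌋ A))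
    intro h = ■-mono (to (truth A ρ (◇ F))
                (h (lift (F ∧ ◆ (◇ F))) (lift (◇ F)) (lift (≼-∧ _ ≼-refl)) (Rᶜ-∧◆ prf-id)))
              ∘ₚ ax-t4 F
    elim : Prf (F ⇒ ■ (sub ⌊ ρ ⌋ A)) → sat (■ A) ρ (lift F)
    elim d G H F≤G (lift (_ , H→◇G)) =
      from (truth A ρ (lower H)) (ax-t3 _ ∘ₚ ◇-mono (d ∘ₚ ≼⇒prf (lower F≤G)) ∘ₚ H→◇G)
  truth (all A)  ρ F = mk⇔ intro elim
    where
    A' = sub (liftS ⌊ ρ ⌋) A
    instance-p : sat (all A) ρ (lift F) → ∀ p → Prf ((wk F ⇒ A') [ atom p ])
    instance-p h p =
      subst (λ D → Prf (D ⇒ A' [ atom p ])) (sym (wk-[] F (atom p)))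
        (subst (λ D → Prf (F ⇒ D)) (⌊extend⌋ A (lift (atom p)) ρ)
          (to (truth A (extend (lift (atom p)) ρ) F) (h (lift F) (lift ≼-refl) (lift (atom p)))))
    intro : sat (all A) ρ (lift F) → Prf (F ⇒ all A')
    intro h = mp (ax-∀K (wk F) A') (gen-∀ (wk F ⇒ A') (instance-p h)) ∘ₚ ax-vac F
    elim : Prf (F ⇒ all A') → sat (all A) ρ (lift F)
    elim d G F≤G C = from (truth A (extend C ρ) (lower G))
      (subst (λ D → Prf (lower G ⇒ D)) (sym (⌊extend⌋ A C ρ))
        (ax-comp A' (lower C) ∘ₚ d ∘ₚ ≼⇒prf (lower F≤G)))

  canonical-comprehensive : Comprehensive
  canonical-comprehensive C ρ = lift (sub ⌊ ρ ⌋ C) , λ G →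
    mk⇔ (λ G⊢C → from (truth C ρ (lower G)) (lower G⊢C)) (λ G⊨C → lift (to (truth C ρ (lower G)) G⊨C))

  canonical-model : Model ℓ
  canonical-model = record { structure = canonical ; comprehensive = canonical-comprehensive }

  complete : (A : Fm 0) → ((𝔅 : Model ℓ) → 𝔅 ⊨ A) → Prf A
  complete A valid = mp (subst (λ D → Prf (⊤ ⇒ D)) closed ⊤⊢A) prf-id
    where
    ⊤ : Fm 0
    ⊤ = atom 0 ⇒ atom 0
    closed : sub ⌊ closedEnv ⌋ A ≡ A
    closed = trans (sub-cong (λ ()) A) (sub-var A)
    ⊤⊢A : Prf (⊤ ⇒ sub ⌊ closedEnv ⌋ A)
    ⊤⊢A = to (truth A closedEnv ⊤) (valid canonical-model (lift ⊤))

theoremA : (ℓ : Level) (A : Fm 0) → Prf A ⇔ ((𝔅 : Model ℓ) → 𝔅 ⊨ A)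
theoremA ℓ A = mk⇔ (λ d 𝔅 → sound d 𝔅 (Birel.closedEnv (Model.structure 𝔅))) (Canonical.complete ℓ A)
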